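{- Let $H$ be a connected graph of order $n'\ge 2$ having $t$ true twin equivalence classes. Then for any integer $n\ge 2$, $\dim_l(K_n\boxtimes H)=nn'-t$. In particular, if $H$ does not have true twin vertices, then $\dim_l(K_n\boxtimes H)=n'(n-1)$.
   Context: $K_n$ is the complete graph on $n$ vertices. Two vertices $u,v$ are true twins if $N_H[u]=N_H[v]$ (closed neighborhoods); the true twin equivalence classes are the classes of the relation $N_H[x]=N_H[y]$. A set $S$ is a local metric generator for a connected graph $G$ if for every two adjacent vertices $x,y$ there is $s\in S$ with $d_G(s,x)\ne d_G(s,y)$; $\dim_l(G)$ is the minimum cardinality of a local metric generator. The strong product $G\boxtimes H$ has vertex set $V(G)\times V(H)$, with $(a,b)\sim(c,d)$ iff ($a=c$ and $b\sim d$) or ($b=d$ and $a\sim c$) or ($a\sim c$ and $b\sim d$). -}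

module Defs where

open import Data.Nat using (ℕ; zero; suc; _<_)
open import Data.Fin using (Fin)
open import Data.Bool using (Bool; true; false; not; _∧_; _∨_; T)
open import Data.Product using (Σ; ∃; _×_; _,_)
open import Data.Sum using (_⊎_)
open import Data.List using (List; length)
open import Data.List.Membership.Propositional using (_∈_)
open import Data.List.Relation.Unary.Unique.Propositional using (Unique)
open import Relation.Nullary using (¬_)
open import Relation.Nullary.Decidable using (⌊_⌋)
open import Relation.Binary.PropositionalEquality using (_≡_; _≢_)
open import Function.Bundles using (_⇔_)
open import Function.Definitions using (Surjective)
import Data.Fin.Properties as FinP

record Graph (V : Set) : Set where
  field
    adj : V → V → Bool

open Graph public

Adj : {V : Set} → Graph V → V → V → Set
Adj G x y = T (adj G x y)

IsSimple : {V : Set} → Graph V → Set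
IsSimple G = (∀ x y → adj G x y ≡ adj G y x) × (∀ x → adj G x x ≡ false)

data Walk {V : Set} (G : Graph V) : V → V → ℕ → Set where
  here : ∀ {x} → Walk G x x zero
  step : ∀ {x y z k} → Adj G x y → Walk G y z k → Walk G x z (suc k)

Connected : {V : Set} → Graph V → Set
Connected G = ∀ x y → ∃ λ k → Walk G x y k

IsDist : {V : Set} → Graph V → V → V → ℕ → Set
IsDist G x y k = Walk G x y k × (∀ m → m < k → ¬ Walk G x y m)

Resolves : {V : Set} → Graph V → V → V → V → Set
Resolves G s x y = ∃ λ k₁ → ∃ λ k₂ → IsDist G s x k₁ × IsDist G s y k₂ × k₁ ≢ k₂

-- sets of vertices are duplicate-free lists; cardinality = length
IsLocalMetricGenerator : {V : Set} → Graph V → List V → Set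
IsLocalMetricGenerator G S =
  Unique S × (∀ x y → Adj G x y → ∃ λ s → s ∈ S × Resolves G s x y)

LocalMetricDim : {V : Set} → Graph V → ℕ → Set
LocalMetricDim G d =
  (∃ λ S → IsLocalMetricGenerator G S × length S ≡ d)
  × (∀ S → IsLocalMetricGenerator G S → d Data.Nat.≤ length S)

K : (n : ℕ) → Graph (Fin n)
K n = record { adj = λ x y → not ⌊ x FinP.≟ y ⌋ }

_⊠_ : {a b : ℕ} → Graph (Fin a) → Graph (Fin b) → Graph (Fin a × Fin b)
G ⊠ H = record { adj = λ where
  (x , y) (u , v) →
    (⌊ x FinP.≟ u ⌋ ∧ adj H y v) ∨ (⌊ y FinP.≟ v ⌋ ∧ adj G x u) ∨ (adj G x u ∧ adj H y v) }

InClosedNbhd : {V : Set} → Graph V → V → V → Set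
InClosedNbhd G x z = z ≡ x ⊎ Adj G x z

TrueTwins : {V : Set} → Graph V → V → V → Set
TrueTwins G x y = ∀ z → InClosedNbhd G x z ⇔ InClosedNbhd G y z

-- H has exactly t true twin classes: a surjection onto Fin t whose fibres are the classes
HasTwinClasses : {V : Set} → Graph V → ℕ → Set
HasTwinClasses {V} G t = Σ (V → Fin t) λ f →
  Surjective _≡_ _≡_ f × (∀ x y → (f x ≡ f y) ⇔ TrueTwins G x y)

NoTrueTwins : {V : Set} → Graph V → Set
NoTrueTwins G = ∀ x y → x ≢ y → ¬ TrueTwins G x y

-- In K n ⊠ H the closed neighbourhood of (i , u) is Fin n × N_H[u], so two vertices are true twins
-- exactly when their H-coordinates are. True twins are equidistant from every other vertex, so a local
-- metric generator misses at most one vertex of each of the t twin classes: it has at least n n′ − t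
-- elements. Conversely, dropping one representative of each class from layer 0 leaves a generator:
-- an adjacent pair with an endpoint in the set is resolved by that endpoint, and two adjacent dropped
-- representatives u, v are not twins in H, so some z lies in exactly one of N_H[u], N_H[v] and (1 , z)
-- is at distance 1 from one of them and 2 from the other.

module Submission where

open import Defs
open import Data.Nat using (ℕ; zero; suc; _+_; _*_; _∸_; _≤_; z≤n; s≤s)
import Data.Nat.Properties as ℕ
open import Data.Fin using (Fin) renaming (zero to 0F; suc to 1+)
import Data.Fin.Properties as FP
open import Data.Product using (_×_; _,_; proj₁; proj₂; ∃)
open import Data.Product.Properties using (≡-dec; ,-injectiveʳ)
open import Data.Product.Function.NonDependent.Propositional using (_×-⇔_)
open import Data.Sum using (_⊎_; inj₁; inj₂)
open import Data.Sum.Function.Propositional using (_⊎-⇔_)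
open import Data.Sum.Properties using (inj₁-injective; inj₂-injective)
open import Data.Bool using (T)
open import Data.Bool.Properties using (T-∧; T-∨)
open import Data.Empty using (⊥; ⊥-elim)
open import Data.List using (List; length; lookup; filter; allFin; cartesianProduct)
open import Data.List.Membership.Propositional using (_∈_; _∉_)
import Data.List.Membership.Propositional.Properties as ∈
import Data.List.Membership.Setoid.Properties as ∈ₛ
open import Data.List.Relation.Unary.Any using (index)
import Data.List.Relation.Unary.All as All
open import Data.List.Relation.Unary.AllPairs using (_∷_)
open import Data.List.Relation.Unary.Unique.Propositional using (Unique)
import Data.List.Relation.Unary.Unique.Propositional.Properties as Unique
open import Relation.Nullary using (¬_; Dec; yes; no; contradiction)
open import Relation.Nullary.Decidable using (⌊_⌋; toWitness; fromWitness; decidable-stable; _×-dec_; _⊎-dec_; ¬?; T?)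
open import Relation.Binary.Definitions using (DecidableEquality; Symmetric)
open import Relation.Binary.PropositionalEquality using (_≡_; _≢_; refl; sym; trans; cong; cong₂; subst; setoid; module ≡-Reasoning)
open import Function using (_∘_)
open import Function.Bundles using (_⇔_; mk⇔; _↔_; _↣_; mk↣; Injection; Equivalence)
open import Function.Construct.Composition using (_↣-∘_)
open import Function.Properties.Equivalence using () renaming (refl to ⇔-refl; sym to ⇔-sym; trans to ⇔-trans)
open import Function.Properties.Inverse using (↔⇒↣; ↔-sym)

open Equivalence using (to; from)

↣⇒≤ : ∀ {A B : Set} {a b} → A ↣ B → Fin a ↔ A → Fin b ↔ B → a ≤ b
↣⇒≤ A↣B a↔A b↔B =
  FP.injective⇒≤ (Injection.injective (↔⇒↣ (↔-sym b↔B) ↣-∘ (A↣B ↣-∘ ↔⇒↣ a↔A)))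

lookup-injective : ∀ {A : Set} {xs : List A} → Unique xs → ∀ i j → lookup xs i ≡ lookup xs j → i ≡ j
lookup-injective (_ ∷ _) 0F 0F _ = refl
lookup-injective (x∉xs ∷ _) 0F (1+ j) e = contradiction e (All.lookup x∉xs (∈.∈-lookup j))
lookup-injective (x∉xs ∷ _) (1+ i) 0F e = contradiction (sym e) (All.lookup x∉xs (∈.∈-lookup i))
lookup-injective (_ ∷ xs-unique) (1+ i) (1+ j) e = cong 1+ (lookup-injective xs-unique i j e)

module Distances {V : Set} (G : Graph V) where

  walk-length-zero : ∀ {x y} → Walk G x y 0 → x ≡ y
  walk-length-zero here = refl

  dist-refl : ∀ x → IsDist G x x 0
  dist-refl x = here , λ _ ()

  dist-one : ∀ {x y} → Adj G x y → x ≢ y → IsDist G x y 1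
  dist-one x~y x≢y = step x~y here , λ
    { zero _ w → x≢y (walk-length-zero w)
    ; (suc _) (s≤s ()) _ }

  dist-two : ∀ {x w y} → Adj G x w → Adj G w y → x ≢ y → ¬ Adj G x y → IsDist G x y 2
  dist-two x~w w~y x≢y x≁y = step x~w (step w~y here) , λ
    { zero _ w → x≢y (walk-length-zero w)
    ; (suc zero) _ (step x~y here) → x≁y x~y
    ; (suc (suc _)) (s≤s (s≤s ())) _ }

  dist-minimal : ∀ {x y k m} → IsDist G x y k → Walk G x y m → k ≤ m
  dist-minimal (_ , shortest) w = ℕ.≮⇒≥ λ m<k → shortest _ m<k w

  resolves-sym : ∀ {s x y} → Resolves G s x y → Resolves G s y x
  resolves-sym (k₁ , k₂ , d₁ , d₂ , k₁≢k₂) = k₂ , k₁ , d₂ , d₁ , k₁≢k₂ ∘ sym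

  resolves-endpoint : ∀ {x y} → Adj G x y → x ≢ y → Resolves G x x y
  resolves-endpoint x~y x≢y = 0 , 1 , dist-refl _ , dist-one x~y x≢y , λ ()

module Twins {V : Set} (G : Graph V) (_≟_ : DecidableEquality V)
             (adj-sym : Symmetric (Adj G)) where

  open Distances G

  resolves-by-private-neighbour : ∀ {s x y} → Adj G x y → InClosedNbhd G x s → s ≢ x →
                                  ¬ InClosedNbhd G y s → Resolves G s x y
  resolves-by-private-neighbour x~y (inj₁ s≡x) s≢x _ = contradiction s≡x s≢x
  resolves-by-private-neighbour x~y (inj₂ x~s) s≢x s∉N[y] =
    1 , 2 , dist-one s~x s≢x ,
    dist-two s~x x~y (s∉N[y] ∘ inj₁) (s∉N[y] ∘ inj₂ ∘ adj-sym) , λ ()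
    where
      s~x = adj-sym x~s

  twins-adjacent : ∀ {x y} → TrueTwins G x y → x ≢ y → Adj G x y
  twins-adjacent {y = y} tw x≢y with from (tw y) (inj₁ refl)
  ... | inj₁ y≡x = contradiction (sym y≡x) x≢y
  ... | inj₂ x~y = x~y

  walk-to-dominator : ∀ {s x y k} → (∀ z → InClosedNbhd G x z → InClosedNbhd G y z) →
                      s ≢ x → Walk G s x k → ∃ λ m → m ≤ k × Walk G s y m
  walk-to-dominator _ s≢x here = contradiction refl s≢x
  walk-to-dominator {s} {x} N[x]⊆N[y] s≢x (step {y = w} s~w w→x) with w ≟ x
  ... | yes refl with N[x]⊆N[y] s (inj₂ (adj-sym s~w))
  ...   | inj₁ refl = 0 , z≤n , here
  ...   | inj₂ y~s = 1 , s≤s z≤n , step (adj-sym y~s) here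
  walk-to-dominator N[x]⊆N[y] s≢x (step s~w w→x) | no w≢x
    with walk-to-dominator N[x]⊆N[y] w≢x w→x
  ... | m , m≤k , w→y = suc m , s≤s m≤k , step s~w w→y

  dist-to-dominator : ∀ {s x y kx ky} → (∀ z → InClosedNbhd G x z → InClosedNbhd G y z) →
                      s ≢ x → IsDist G s x kx → IsDist G s y ky → ky ≤ kx
  dist-to-dominator N[x]⊆N[y] s≢x (s→x , _) dy with walk-to-dominator N[x]⊆N[y] s≢x s→x
  ... | m , m≤kx , s→y = ℕ.≤-trans (dist-minimal dy s→y) m≤kx

  twins-equidistant : ∀ {s x y kx ky} → TrueTwins G x y → s ≢ x → s ≢ y →
                      IsDist G s x kx → IsDist G s y ky → kx ≡ ky
  twins-equidistant tw s≢x s≢y dx dy = ℕ.≤-antisym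
    (dist-to-dominator (λ z → from (tw z)) s≢y dy dx)
    (dist-to-dominator (λ z → to (tw z)) s≢x dx dy)

  generator-meets-twins : ∀ {S x y} → IsLocalMetricGenerator G S → TrueTwins G x y → x ≢ y →
                          x ∉ S → y ∉ S → ⊥
  generator-meets-twins (_ , resolving) tw x≢y x∉S y∉S
    with resolving _ _ (twins-adjacent tw x≢y)
  ... | s , s∈S , _ , _ , ds , dy , kx≢ky =
    kx≢ky (twins-equidistant tw (λ { refl → x∉S s∈S }) (λ { refl → y∉S s∈S }) ds dy)

  generator-size : ∀ {N t S} → Fin N ↔ V → (f : V → Fin t) →
                   (∀ x y → f x ≡ f y → TrueTwins G x y) →
                   IsLocalMetricGenerator G S → N ∸ t ≤ length S
  generator-size {N} {t} {S} N↔V f same-class⇒twins gen =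
    ℕ.m≤n+o⇒m∸n≤o N t (↣⇒≤ code N↔V FP.+↔⊎)
    where
      open import Data.List.Membership.DecPropositional _≟_ using (_∈?_)

      encode : ∀ p → Dec (p ∈ S) → Fin t ⊎ Fin (length S)
      encode p (yes p∈S) = inj₂ (index p∈S)
      encode p (no _) = inj₁ (f p)

      encode-injective : ∀ p q p∈?S q∈?S → encode p p∈?S ≡ encode q q∈?S → p ≡ q
      encode-injective p q (yes p∈S) (yes q∈S) e =
        ∈ₛ.index-injective (setoid V) p∈S q∈S (inj₂-injective e)
      encode-injective p q (yes _) (no _) ()
      encode-injective p q (no _) (yes _) ()
      encode-injective p q (no p∉S) (no q∉S) e with p ≟ q
      ... | yes p≡q = p≡q
      ... | no p≢q =
        ⊥-elim (generator-meets-twins gen (same-class⇒twins p q (inj₁-injective e)) p≢q p∉S q∉S)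

      code : V ↣ (Fin t ⊎ Fin (length S))
      code = mk↣ {to = λ p → encode p (p ∈? S)}
                 λ {p} {q} → encode-injective p q (p ∈? S) (q ∈? S)

closedNbhd? : ∀ {k} (H : Graph (Fin k)) u z → Dec (InClosedNbhd H u z)
closedNbhd? H u z = (z FP.≟ u) ⊎-dec T? (adj H u z)

distinguishing-vertex : ∀ {k} (H : Graph (Fin k)) {u v} → ¬ TrueTwins H u v →
                        ∃ λ z → (InClosedNbhd H u z × ¬ InClosedNbhd H v z)
                              ⊎ (InClosedNbhd H v z × ¬ InClosedNbhd H u z)
distinguishing-vertex H {u} {v} ¬twins
  with FP.any? (λ z → (closedNbhd? H u z ×-dec ¬? (closedNbhd? H v z))
                    ⊎-dec (closedNbhd? H v z ×-dec ¬? (closedNbhd? H u z)))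
... | yes found = found
... | no none = contradiction twins ¬twins
  where
    twins : TrueTwins H u v
    twins z = mk⇔
      (λ uz → decidable-stable (closedNbhd? H v z) λ ¬vz → none (z , inj₁ (uz , ¬vz)))
      (λ vz → decidable-stable (closedNbhd? H u z) λ ¬uz → none (z , inj₂ (vz , ¬uz)))

module TwinClasses {k t} {H : Graph (Fin k)} (classes : HasTwinClasses H t) where

  class : Fin k → Fin t
  class = proj₁ classes

  representative : Fin t → Fin k
  representative c = proj₁ (proj₁ (proj₂ classes) c)

  class-representative : ∀ c → class (representative c) ≡ c
  class-representative c = proj₂ (proj₁ (proj₂ classes) c) refl

  same-class⇔twins : ∀ u v → (class u ≡ class v) ⇔ TrueTwins H u v
  same-class⇔twins = proj₂ (proj₂ classes)

  representative-injective : ∀ {c d} → representative c ≡ representative d → c ≡ d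
  representative-injective {c} {d} e =
    trans (sym (class-representative c)) (trans (cong class e) (class-representative d))

  noTrueTwins⇒classes≡vertices : NoTrueTwins H → t ≡ k
  noTrueTwins⇒classes≡vertices noTwins =
    FP.cantor-schröder-bernstein representative-injective class-injective
    where
      class-injective : ∀ {u v} → class u ≡ class v → u ≡ v
      class-injective {u} {v} e with u FP.≟ v
      ... | yes u≡v = u≡v
      ... | no u≢v = contradiction (to (same-class⇔twins u v) e) (noTwins u v u≢v)

simple⇒symmetric : ∀ {V} {G : Graph V} → IsSimple G → Symmetric (Adj G)
simple⇒symmetric (adj-sym , _) {x} {y} = subst T (adj-sym x y)

simple⇒irreflexive : ∀ {V} {G : Graph V} → IsSimple G → ∀ x → ¬ Adj G x x
simple⇒irreflexive (_ , loopless) x = subst T (loopless x)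

K-Adj⇔ : ∀ {n} {i j : Fin n} → Adj (K n) i j ⇔ (i ≢ j)
K-Adj⇔ {i = i} {j} with i FP.≟ j
... | yes i≡j = mk⇔ (λ ()) (λ i≢j → i≢j i≡j)
... | no i≢j = mk⇔ (λ _ → i≢j) _

K-symmetric : ∀ {n} → Symmetric (Adj (K n))
K-symmetric i~j = from K-Adj⇔ (to K-Adj⇔ i~j ∘ sym)

K-closedNbhd : ∀ {n} (i j : Fin n) → InClosedNbhd (K n) i j
K-closedNbhd i j with j FP.≟ i
... | yes j≡i = inj₁ j≡i
... | no j≢i = inj₂ (from K-Adj⇔ (j≢i ∘ sym))

K-trueTwins : ∀ {n} (i j : Fin n) → TrueTwins (K n) i j
K-trueTwins i j z = mk⇔ (λ _ → K-closedNbhd j z) (λ _ → K-closedNbhd i z)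

module StrongProduct {a b} (G : Graph (Fin a)) (H : Graph (Fin b)) where

  ⊠-Adj⇔ : ∀ i j u v → Adj (G ⊠ H) (i , u) (j , v) ⇔
           ((i ≡ j × Adj H u v) ⊎ (u ≡ v × Adj G i j) ⊎ (Adj G i j × Adj H u v))
  ⊠-Adj⇔ _ _ _ _ = ⇔-trans T-∨ (⇔-trans T-∧ (T-≟ ×-⇔ ⇔-refl)
                    ⊎-⇔ ⇔-trans T-∨ (⇔-trans T-∧ (T-≟ ×-⇔ ⇔-refl) ⊎-⇔ T-∧))
    where
      T-≟ : ∀ {n} {x y : Fin n} → T ⌊ x FP.≟ y ⌋ ⇔ (x ≡ y)
      T-≟ = mk⇔ toWitness fromWitness

  ⊠-symmetric : Symmetric (Adj G) → Symmetric (Adj H) → Symmetric (Adj (G ⊠ H))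
  ⊠-symmetric G-sym H-sym {i , u} {j , v} p~q with to (⊠-Adj⇔ i j u v) p~q
  ... | inj₁ (refl , u~v) = from (⊠-Adj⇔ j i v u) (inj₁ (refl , H-sym u~v))
  ... | inj₂ (inj₁ (refl , i~j)) = from (⊠-Adj⇔ j i v u) (inj₂ (inj₁ (refl , G-sym i~j)))
  ... | inj₂ (inj₂ (i~j , u~v)) = from (⊠-Adj⇔ j i v u) (inj₂ (inj₂ (G-sym i~j , H-sym u~v)))

  ⊠-irreflexive : (∀ i → ¬ Adj G i i) → (∀ u → ¬ Adj H u u) → ∀ p → ¬ Adj (G ⊠ H) p p
  ⊠-irreflexive G-irr H-irr (i , u) p~p with to (⊠-Adj⇔ i i u u) p~p
  ... | inj₁ (_ , u~u) = H-irr u u~u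
  ... | inj₂ (inj₁ (_ , i~i)) = G-irr i i~i
  ... | inj₂ (inj₂ (i~i , _)) = G-irr i i~i

  ⊠-closedNbhd⇔ : ∀ {i j u v} → InClosedNbhd (G ⊠ H) (i , u) (j , v) ⇔
                  (InClosedNbhd G i j × InClosedNbhd H u v)
  ⊠-closedNbhd⇔ = mk⇔ split merge
    where
      split : ∀ {i j u v} → InClosedNbhd (G ⊠ H) (i , u) (j , v) →
              InClosedNbhd G i j × InClosedNbhd H u v
      split (inj₁ refl) = inj₁ refl , inj₁ refl
      split {i} {j} {u} {v} (inj₂ p~q) with to (⊠-Adj⇔ i j u v) p~q
      ... | inj₁ (refl , u~v) = inj₁ refl , inj₂ u~v
      ... | inj₂ (inj₁ (refl , i~j)) = inj₂ i~j , inj₁ refl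
      ... | inj₂ (inj₂ (i~j , u~v)) = inj₂ i~j , inj₂ u~v

      merge : ∀ {i j u v} → InClosedNbhd G i j × InClosedNbhd H u v →
              InClosedNbhd (G ⊠ H) (i , u) (j , v)
      merge (inj₁ refl , inj₁ refl) = inj₁ refl
      merge {i} {j} {u} {v} (inj₁ refl , inj₂ u~v) =
        inj₂ (from (⊠-Adj⇔ i j u v) (inj₁ (refl , u~v)))
      merge {i} {j} {u} {v} (inj₂ i~j , inj₁ refl) =
        inj₂ (from (⊠-Adj⇔ i j u v) (inj₂ (inj₁ (refl , i~j))))
      merge {i} {j} {u} {v} (inj₂ i~j , inj₂ u~v) =
        inj₂ (from (⊠-Adj⇔ i j u v) (inj₂ (inj₂ (i~j , u~v))))

  ⊠-trueTwins : ∀ {i j u v} → TrueTwins G i j → TrueTwins H u v →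
                TrueTwins (G ⊠ H) (i , u) (j , v)
  ⊠-trueTwins i≈j u≈v (k , w) =
    ⇔-trans ⊠-closedNbhd⇔ (⇔-trans (i≈j k ×-⇔ u≈v w) (⇔-sym ⊠-closedNbhd⇔))

module StrongProductWithComplete {n′ t} (m : ℕ) (H : Graph (Fin n′)) (H-simple : IsSimple H)
                                 (classes : HasTwinClasses H t) where

  n : ℕ
  n = 2 + m

  open TwinClasses classes
  open StrongProduct (K n) H

  V : Set
  V = Fin n × Fin n′

  P : Graph V
  P = K n ⊠ H

  -- Vertices are explicit here: Adj P reduces to a Boolean expression, so they cannot be inferred.
  P-symmetric : ∀ x y → Adj P x y → Adj P y x
  P-symmetric x y = ⊠-symmetric K-symmetric (simple⇒symmetric H-simple) {x} {y}

  adjacent⇒distinct : ∀ x y → Adj P x y → x ≢ y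
  adjacent⇒distinct x _ x~y refl =
    ⊠-irreflexive (λ _ i~i → to K-Adj⇔ i~i refl) (simple⇒irreflexive H-simple) x x~y

  open Distances P
  open Twins P (≡-dec FP._≟_ FP._≟_) (λ {x} {y} → P-symmetric x y)

  IsRepresentative : V → Set
  IsRepresentative (i , u) = i ≡ 0F × u ≡ representative (class u)

  isRepresentative? : ∀ p → Dec (IsRepresentative p)
  isRepresentative? (i , u) = (i FP.≟ 0F) ×-dec (u FP.≟ representative (class u))

  vertices : List V
  vertices = cartesianProduct (allFin n) (allFin n′)

  nonRepresentatives : List V
  nonRepresentatives = filter (¬? ∘ isRepresentative?) vertices

  nonRepresentatives-unique : Unique nonRepresentatives
  nonRepresentatives-unique = Unique.filter⁺ (¬? ∘ isRepresentative?)
    (Unique.cartesianProduct⁺ (Unique.allFin⁺ n) (Unique.allFin⁺ n′))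

  ∈-nonRepresentatives : ∀ p → ¬ IsRepresentative p → p ∈ nonRepresentatives
  ∈-nonRepresentatives (i , u) =
    ∈.∈-filter⁺ (¬? ∘ isRepresentative?) (∈.∈-cartesianProduct⁺ (∈.∈-allFin i) (∈.∈-allFin u))

  ∈-nonRepresentatives⁻ : ∀ {p} → p ∈ nonRepresentatives → ¬ IsRepresentative p
  ∈-nonRepresentatives⁻ = proj₂ ∘ ∈.∈-filter⁻ (¬? ∘ isRepresentative?) {xs = vertices}

  representatives-not-twins : ∀ {u v} → Adj P (0F , u) (0F , v) →
                              u ≡ representative (class u) → v ≡ representative (class v) →
                              ¬ TrueTwins H u v
  representatives-not-twins {u} {v} x~y u-rep v-rep u≈v =
    adjacent⇒distinct _ _ x~y (cong (0F ,_) (begin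
      u                         ≡⟨ u-rep ⟩
      representative (class u)  ≡⟨ cong representative (from (same-class⇔twins u v) u≈v) ⟩
      representative (class v)  ≡⟨ v-rep ⟨
      v                         ∎))
    where open ≡-Reasoning

  representatives-resolved : ∀ {u v} → Adj P (0F , u) (0F , v) →
                             u ≡ representative (class u) → v ≡ representative (class v) →
                             ∃ λ s → s ∈ nonRepresentatives × Resolves P s (0F , u) (0F , v)
  representatives-resolved {u} {v} x~y u-rep v-rep
    with distinguishing-vertex H (representatives-not-twins x~y u-rep v-rep)
  ... | z , inj₁ (uz , ¬vz) =
    (1+ 0F , z) , ∈-nonRepresentatives _ (λ ()) ,
    resolves-by-private-neighbour x~y (from ⊠-closedNbhd⇔ (K-closedNbhd 0F (1+ 0F) , uz)) (λ ())
      (¬vz ∘ proj₂ ∘ to ⊠-closedNbhd⇔)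
  ... | z , inj₂ (vz , ¬uz) =
    (1+ 0F , z) , ∈-nonRepresentatives _ (λ ()) ,
    resolves-sym (resolves-by-private-neighbour (P-symmetric (0F , u) (0F , v) x~y)
      (from ⊠-closedNbhd⇔ (K-closedNbhd 0F (1+ 0F) , vz)) (λ ()) (¬uz ∘ proj₂ ∘ to ⊠-closedNbhd⇔))

  nonRepresentatives-generator : IsLocalMetricGenerator P nonRepresentatives
  nonRepresentatives-generator = nonRepresentatives-unique , resolved
    where
      resolved : ∀ x y → Adj P x y → ∃ λ s → s ∈ nonRepresentatives × Resolves P s x y
      resolved x y x~y with isRepresentative? x | isRepresentative? y
      ... | no x-free | _ =
        x , ∈-nonRepresentatives x x-free , resolves-endpoint x~y (adjacent⇒distinct x y x~y)
      ... | yes _ | no y-free =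
        y , ∈-nonRepresentatives y y-free ,
        resolves-sym (resolves-endpoint y~x (adjacent⇒distinct y x y~x))
        where y~x = P-symmetric x y x~y
      ... | yes (refl , u-rep) | yes (refl , v-rep) = representatives-resolved x~y u-rep v-rep

  nonRepresentatives-size : length nonRepresentatives ≤ n * n′ ∸ t
  nonRepresentatives-size =
    ℕ.m+n≤o⇒m≤o∸n (length nonRepresentatives)
      (↣⇒≤ (mk↣ {to = embed} embed-injective) FP.+↔⊎ FP.*↔×)
    where
      embed : Fin (length nonRepresentatives) ⊎ Fin t → V
      embed (inj₁ i) = lookup nonRepresentatives i
      embed (inj₂ c) = 0F , representative c

      representative-chosen : ∀ c → IsRepresentative (0F , representative c)
      representative-chosen c = refl , cong representative (sym (class-representative c))

      embed-injective : ∀ {a b} → embed a ≡ embed b → a ≡ b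
      embed-injective {inj₁ i} {inj₁ j} e = cong inj₁ (lookup-injective nonRepresentatives-unique i j e)
      embed-injective {inj₁ i} {inj₂ c} e = contradiction
        (subst IsRepresentative (sym e) (representative-chosen c)) (∈-nonRepresentatives⁻ (∈.∈-lookup i))
      embed-injective {inj₂ c} {inj₁ i} e = contradiction
        (subst IsRepresentative e (representative-chosen c)) (∈-nonRepresentatives⁻ (∈.∈-lookup i))
      embed-injective {inj₂ c} {inj₂ d} e = cong inj₂ (representative-injective (,-injectiveʳ e))

  localMetricDim : LocalMetricDim P (n * n′ ∸ t)
  localMetricDim =
    (nonRepresentatives , nonRepresentatives-generator ,
       ℕ.≤-antisym nonRepresentatives-size (lower-bound nonRepresentatives-generator)) ,
    λ _ → lower-bound
    where
      lower-bound : ∀ {S} → IsLocalMetricGenerator P S → n * n′ ∸ t ≤ length S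
      lower-bound = generator-size FP.*↔× (class ∘ proj₂)
        λ (i , u) (j , v) same → ⊠-trueTwins (K-trueTwins i j) (to (same-class⇔twins u v) same)

corollary12 : (n′ : ℕ) → (H : Graph (Fin n′)) → IsSimple H → Connected H → 2 ≤ n′ → (t : ℕ) → HasTwinClasses H t → (n : ℕ) → 2 ≤ n → LocalMetricDim (K n ⊠ H) (n * n′ ∸ t) × (NoTrueTwins H → LocalMetricDim (K n ⊠ H) (n′ * (n ∸ 1)))
corollary12 n′ H H-simple _ _ t classes (suc (suc m)) (s≤s (s≤s z≤n)) =
  localMetricDim ,
  λ noTwins → subst (LocalMetricDim (K n ⊠ H)) (count-without-twins noTwins) localMetricDim
  where
    open StrongProductWithComplete m H H-simple classes using (n; localMetricDim)
    open TwinClasses classes using (noTrueTwins⇒classes≡vertices)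

    count-without-twins : NoTrueTwins H → n * n′ ∸ t ≡ n′ * (n ∸ 1)
    count-without-twins noTwins = begin
      n * n′ ∸ t       ≡⟨ cong (n * n′ ∸_) (noTrueTwins⇒classes≡vertices noTwins) ⟩
      n * n′ ∸ n′      ≡⟨ cong₂ _∸_ (ℕ.*-comm n n′) (sym (ℕ.*-identityʳ n′)) ⟩
      n′ * n ∸ n′ * 1  ≡⟨ ℕ.*-distribˡ-∸ n′ n 1 ⟨
      n′ * (n ∸ 1)     ∎
      where open ≡-Reasoning
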